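{- Let $A$ be a totally filled $n\times m$ toroidal array, and let $0\le l\le m$. Let $R=(1,1,\dots,1)\in\{ -1,1\}^n$, and let $C\in\{ -1,1\}^m$ have $c_1=\dots=c_{m-l}=1$ and $c_{m-l+1}=\dots=c_m=-1$. Then $R$ and $C$ are a solution of $P(A)$ if and only if $\gcd(m-2l,n)=1$.
   Context: Arrays are toroidal: an $n\times m$ array has rows indexed modulo $n$ and columns modulo $m$ (representatives $1,\dots,n$ and $1,\dots,m$). $F(A)$ is the set of filled cells; here all cells are filled. For $(i,j)\in F(A)$: - the row successor $s_r((i,j))$ is $(i,j+k)$ with $k\ge1$ minimal such that $(i,j+k)\in F(A)$; - the column successor $s_c((i,j))$ is $(i+k,j)$ with $k\ge1$ minimal such that $(i+k,j)\in F(A)$. Given $R,C$, the move function is $S_{R,C}((i,j))=s_c^{\,c_{j'}}((i,j'))$, where $(i,j')=s_r^{\,r_i}((i,j))$; exponent $-1$ means inverse. For a totally filled array, $S_{R,C}((i,j))=(i+c_{j+r_i},\,j+r_i)$. $R,C$ is a solution of $P(A)$ if $S_{R,C}$ is a single cycle on $F(A)$. The convention $\gcd(0,n)=n$ applies. -}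

module Defs where

open import Data.Nat using (ℕ; zero; suc; _+_; _∸_; _<ᵇ_; NonZero)
open import Data.Nat.DivMod using (_mod_)
open import Data.Fin using (Fin; toℕ)
open import Data.Product using (_×_; _,_; ∃)
open import Data.Bool using (if_then_else_)
open import Relation.Binary.PropositionalEquality using (_≡_)
open import Function using (_∘_)

data Sign : Set where
  plus minus : Sign

-- Toroidal index shift by +1 / -1 on indices 0..k-1 (cyclic).
-- (The paper indexes 1..k; we use 0-based representatives 0..k-1.)
shift : (k : ℕ) .{{_ : NonZero k}} → Sign → Fin k → Fin k
shift k plus  i = (toℕ i + 1) mod k
shift k minus i = (toℕ i + (k ∸ 1)) mod k

-- Cells of a (totally filled) n × m toroidal array: F(A) = all of them.
Cell : ℕ → ℕ → Set
Cell n m = Fin n × Fin m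

module _ (n m : ℕ) .{{_ : NonZero n}} .{{_ : NonZero m}} where

  sᵣ^ : Sign → Cell n m → Cell n m
  sᵣ^ e (i , j) = (i , shift m e j)

  s꜀^ : Sign → Cell n m → Cell n m
  s꜀^ e (i , j) = (shift n e i , j)

  move : (Fin n → Sign) → (Fin m → Sign) → Cell n m → Cell n m
  move R C (i , j) with sᵣ^ (R i) (i , j)
  ... | (i' , j') = s꜀^ (C j') (i' , j')

iter : {A : Set} → (A → A) → ℕ → A → A
iter f zero    x = x
iter f (suc k) x = f (iter f k x)

-- A permutation f of a finite (nonempty) set is a single cycle iff every
-- element is reachable from every element by iterating f.
IsSingleCycle : {A : Set} → (A → A) → Set
IsSingleCycle {A} f = (x y : A) → ∃ λ k → iter f k x ≡ y

IsSolution : (n m : ℕ) .{{_ : NonZero n}} .{{_ : NonZero m}} →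
             (Fin n → Sign) → (Fin m → Sign) → Set
IsSolution n m R C = IsSingleCycle (move n m R C)

allPlus : (n : ℕ) → Fin n → Sign
allPlus n _ = plus

-- C with c_1 = ... = c_{m-l} = 1 and c_{m-l+1} = ... = c_m = -1
-- (0-based column j corresponds to paper column j+1).
splitC : (m l : ℕ) → Fin m → Sign
splitC m l j = if toℕ j <ᵇ (m ∸ l) then plus else minus

module Submission where

-- In a totally filled n × m array with R = (1,…,1), every move goes one
-- column to the right and changes the row by +1 or -1 according to the sign
-- of the column it lands in.  Such a "skew shift" of the torus is governed by
-- its total row displacement D over one full turn through all m columns:
-- after q·m moves the column is unchanged and the row has moved by q·D.
-- Hence the move function is a single cycle iff the multiples of D reach
-- every residue modulo n, i.e. iff D is coprime to n.  For the given C the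
-- displacement is D = (m - l) + l·(n - 1) ≡ m - 2l (mod n), and coprimality
-- with n only depends on the residue up to sign, giving gcd(|m - 2l|, n) = 1.

open import Defs
open import Data.Nat using (ℕ; _*_; _≤_; NonZero; ∣_-_∣)
open import Data.Nat.GCD using (gcd)
open import Relation.Binary.PropositionalEquality using (_≡_)
open import Function.Bundles using (_⇔_)

open import Data.Nat using (zero; suc; _+_; _∸_; _<_; _<ᵇ_; _%_; _/_; s≤s; >-nonZero⁻¹)
open import Data.Nat.Properties
open import Data.Nat.DivMod
open import Data.Nat.Divisibility
  using (_∣_; divides; ∣m∣n⇒∣m+n; ∣m+n∣m⇒∣n; ∣n⇒∣m*n; ∣1⇒≡1; %-presˡ-∣; ∣n∣m%n⇒∣m)
open import Data.Nat.Coprimality using (Coprime; coprime⇒gcd≡1; gcd≡1⇒coprime; coprime-Bézout)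
open import Data.Nat.GCD using (module Bézout)
open import Data.Nat.Tactic.RingSolver using (solve-∀)
open import Data.Fin using (Fin; toℕ)
open import Data.Fin.Properties using (toℕ-fromℕ<; toℕ-injective; toℕ<n)
open import Data.Product using (_,_; proj₁; proj₂; ∃)
open import Data.Sum using (inj₁; inj₂)
open import Data.Bool using (true; false; if_then_else_)
open import Relation.Binary.PropositionalEquality using (refl; sym; trans; cong; cong₂; subst; module ≡-Reasoning)
open import Function using (_∘_)
open import Function.Bundles using (mk⇔)
open import Function.Properties.Equivalence using () renaming (trans to ⇔-trans)

open ≡-Reasoning

module Residues {n : ℕ} .{{_ : NonZero n}} where

  %-cong-+ˡ : ∀ a {b b'} → b % n ≡ b' % n → (a + b) % n ≡ (a + b') % n
  %-cong-+ˡ a {b} {b'} eq = begin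
    (a + b) % n              ≡⟨ %-distribˡ-+ a b n ⟩
    (a % n + b % n) % n      ≡⟨ cong (λ r → (a % n + r) % n) eq ⟩
    (a % n + b' % n) % n     ≡⟨ sym (%-distribˡ-+ a b' n) ⟩
    (a + b') % n             ∎

  %-cong-+ʳ : ∀ {a a'} b → a % n ≡ a' % n → (a + b) % n ≡ (a' + b) % n
  %-cong-+ʳ {a} {a'} b eq = begin
    (a + b) % n   ≡⟨ cong (_% n) (+-comm a b) ⟩
    (b + a) % n   ≡⟨ %-cong-+ˡ b eq ⟩
    (b + a') % n  ≡⟨ cong (_% n) (+-comm b a') ⟩
    (a' + b) % n  ∎

  complement-divisible : ∀ a → n ∣ a + (n ∸ a % n)
  complement-divisible a = divides (suc (a / n)) (begin
    a + (n ∸ a % n)                          ≡⟨ cong (_+ (n ∸ a % n)) (m≡m%n+[m/n]*n a n) ⟩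
    a % n + a / n * n + (n ∸ a % n)          ≡⟨ regroup (a % n) (a / n * n) (n ∸ a % n) ⟩
    (a % n + (n ∸ a % n)) + a / n * n        ≡⟨ cong (_+ a / n * n) (m+[n∸m]≡n (m%n≤n a n)) ⟩
    suc (a / n) * n                          ∎)
    where
    regroup : ∀ x y z → x + y + z ≡ (x + z) + y
    regroup = solve-∀

  catch-up : ∀ a b → (a + (n ∸ a % n + b)) % n ≡ b % n
  catch-up a b = trans (cong (_% n) (sym (+-assoc a (n ∸ a % n) b)))
                       (%-remove-+ˡ b (complement-divisible a))

  invertible⇒coprime : ∀ {D} q → (q * D) % n ≡ 1 % n → Coprime D n
  invertible⇒coprime {D} q qD≡1 (d∣D , d∣n) = ∣1⇒≡1 (∣n∣m%n⇒∣m d∣n d∣1%n)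
    where
    d∣1%n = subst (_ ∣_) qD≡1 (%-presˡ-∣ (∣n⇒∣m*n q d∣D) d∣n)

coprime⇒invertible : ∀ {D n} .{{_ : NonZero n}} → Coprime D n → ∃ λ u → (u * D) % n ≡ 1 % n
coprime⇒invertible {D} {suc n'} c with coprime-Bézout c
... | Bézout.+- x y 1+yn≡xD = x , (begin
  (x * D) % n       ≡⟨ cong (_% n) (sym 1+yn≡xD) ⟩
  (1 + y * n) % n   ≡⟨ [m+kn]%n≡m%n 1 y n ⟩
  1 % n             ∎)
  where n = suc n'
... | Bézout.-+ x y 1+xD≡yn = x * n' , (begin
  (x * n' * D) % n                ≡⟨ sym ([m+kn]%n≡m%n (x * n' * D) 1 n) ⟩
  (x * n' * D + 1 * n) % n        ≡⟨ cong (_% n) (expand x n' D) ⟩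
  (1 + n' * (1 + x * D)) % n      ≡⟨ cong (λ z → (1 + n' * z) % n) 1+xD≡yn ⟩
  (1 + n' * (y * n)) % n          ≡⟨ cong (λ z → (1 + z) % n) (sym (*-assoc n' y n)) ⟩
  (1 + n' * y * n) % n            ≡⟨ [m+kn]%n≡m%n 1 (n' * y) n ⟩
  1 % n                           ∎)
  where
  n = suc n'
  -- From x·D ≡ -1 (mod n): multiplying by n - 1 ≡ -1 gives x·(n-1)·D ≡ 1.
  expand : ∀ x n' D → x * n' * D + 1 * suc n' ≡ 1 + n' * (1 + x * D)
  expand = solve-∀

coprime⇒multiples-hit : ∀ {D n} .{{_ : NonZero n}} → Coprime D n →
                        ∀ a → ∃ λ q → (q * D) % n ≡ a % n
coprime⇒multiples-hit {D} {n} c a = u * a , (begin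
  (u * a * D) % n              ≡⟨ cong (_% n) (reorder u a D) ⟩
  (a * (u * D)) % n            ≡⟨ %-distribˡ-* a (u * D) n ⟩
  (a % n * ((u * D) % n)) % n  ≡⟨ cong (λ r → (a % n * r) % n) uD≡1 ⟩
  (a % n * (1 % n)) % n        ≡⟨ sym (%-distribˡ-* a 1 n) ⟩
  (a * 1) % n                  ≡⟨ cong (_% n) (*-identityʳ a) ⟩
  a % n                        ∎)
  where
  u = proj₁ (coprime⇒invertible c)
  uD≡1 = proj₂ (coprime⇒invertible c)
  reorder : ∀ u a D → u * a * D ≡ a * (u * D)
  reorder = solve-∀

coprime-transfer : ∀ {a b n} → (∀ {d} → d ∣ n → d ∣ b → d ∣ a) → Coprime a n → Coprime b n
coprime-transfer divides-a c (d∣b , d∣n) = c (divides-a d∣n d∣b , d∣n)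

coprime-+-multiple : ∀ {a b k n} → a ≡ b + k * n → Coprime a n ⇔ Coprime b n
coprime-+-multiple {a} {b} {k} a≡b+kn = mk⇔
  (coprime-transfer λ d∣n d∣b → subst (_ ∣_) (sym a≡b+kn) (∣m∣n⇒∣m+n d∣b (∣n⇒∣m*n k d∣n)))
  (coprime-transfer λ d∣n d∣a → ∣m+n∣m⇒∣n (subst (_ ∣_) (trans a≡b+kn (+-comm b (k * _))) d∣a)
                                          (∣n⇒∣m*n k d∣n))

coprime-negation : ∀ {a b k n} → a + b ≡ k * n → Coprime a n → Coprime b n
coprime-negation {a} {b} {k} a+b≡kn = coprime-transfer λ {d} d∣n d∣b →
  ∣m+n∣m⇒∣n (subst (d ∣_) (trans (sym a+b≡kn) (+-comm a b)) (∣n⇒∣m*n k d∣n)) d∣b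

coprime-difference : ∀ {D a b k n} → D + b ≡ a + k * n → Coprime D n ⇔ Coprime ∣ a - b ∣ n
coprime-difference {D} {a} {b} {k} {n} D+b≡a+kn with ≤-total b a
... | inj₁ b≤a = subst (λ e → Coprime D n ⇔ Coprime e n) (sym (m≤n⇒∣n-m∣≡n∸m b≤a))
                       (coprime-+-multiple {k = k} (+-cancelʳ-≡ b D (a ∸ b + k * n) (begin
  D + b                  ≡⟨ D+b≡a+kn ⟩
  a + k * n              ≡⟨ cong (_+ k * n) (sym (m∸n+n≡m b≤a)) ⟩
  a ∸ b + b + k * n      ≡⟨ swap (a ∸ b) b (k * n) ⟩
  a ∸ b + k * n + b      ∎)))
  where
  swap : ∀ x y z → x + y + z ≡ x + z + y
  swap = solve-∀
... | inj₂ a≤b = subst (λ e → Coprime D n ⇔ Coprime e n) (sym (m≤n⇒∣m-n∣≡n∸m a≤b))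
                       (mk⇔ (coprime-negation {k = k} D+e≡kn)
                            (coprime-negation {k = k} (trans (+-comm (b ∸ a) D) D+e≡kn)))
  where
  D+e≡kn : D + (b ∸ a) ≡ k * n
  D+e≡kn = +-cancelʳ-≡ a (D + (b ∸ a)) (k * n) (begin
    D + (b ∸ a) + a   ≡⟨ +-assoc D (b ∸ a) a ⟩
    D + (b ∸ a + a)   ≡⟨ cong (D +_) (m∸n+n≡m a≤b) ⟩
    D + b             ≡⟨ D+b≡a+kn ⟩
    a + k * n         ≡⟨ +-comm a (k * n) ⟩
    k * n + a         ∎)

module _ {k : ℕ} .{{_ : NonZero k}} where

  toℕ-mod : ∀ a → toℕ (a mod k) ≡ a % k
  toℕ-mod a = toℕ-fromℕ< _

  mod-cong : ∀ {a b} → a % k ≡ b % k → a mod k ≡ b mod k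
  mod-cong {a} {b} eq = toℕ-injective (trans (toℕ-mod a) (trans eq (sym (toℕ-mod b))))

  mod-toℕ : (i : Fin k) → toℕ i mod k ≡ i
  mod-toℕ i = toℕ-injective (trans (toℕ-mod (toℕ i)) (m<n⇒m%n≡m (toℕ<n i)))

cellAt : ∀ {n m} .{{_ : NonZero n}} .{{_ : NonZero m}} → ℕ → ℕ → Cell n m
cellAt {n} {m} x y = x mod n , y mod m

module _ {n m : ℕ} .{{_ : NonZero n}} .{{_ : NonZero m}} where

  cellAt-cong : ∀ {x x' y y'} → x % n ≡ x' % n → y % m ≡ y' % m →
                cellAt {n} {m} x y ≡ cellAt x' y'
  cellAt-cong rows cols = cong₂ _,_ (mod-cong rows) (mod-cong cols)

  cellAt-row : ∀ {x x' y y'} → cellAt {n} {m} x y ≡ cellAt x' y' → x % n ≡ x' % n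
  cellAt-row {x} {x'} eq = trans (sym (toℕ-mod x)) (trans (cong (toℕ ∘ proj₁) eq) (toℕ-mod x'))

  cellAt-column : ∀ {x x' y y'} → cellAt {n} {m} x y ≡ cellAt x' y' → y % m ≡ y' % m
  cellAt-column {y = y} {y'} eq = trans (sym (toℕ-mod y)) (trans (cong (toℕ ∘ proj₂) eq) (toℕ-mod y'))

  cellAt-toℕ : (i : Fin n) (j : Fin m) → cellAt (toℕ i) (toℕ j) ≡ (i , j)
  cellAt-toℕ i j = cong₂ _,_ (mod-toℕ i) (mod-toℕ j)

iter-+ : ∀ {A : Set} (g : A → A) a b x → iter g (a + b) x ≡ iter g a (iter g b x)
iter-+ g zero    b x = refl
iter-+ g (suc a) b x = cong g (iter-+ g a b x)

module SkewShift {n m : ℕ} .{{_ : NonZero n}} .{{_ : NonZero m}}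
                 (δ : Fin m → ℕ) (f : Cell n m → Cell n m)
                 (f-step : ∀ x y → f (cellAt x y) ≡ cellAt (x + δ (suc y mod m)) (suc y)) where

  open Residues

  disp : ℕ → ℕ
  disp y = δ (y mod m)

  disp-periodic : ∀ y → disp (y + m) ≡ disp y
  disp-periodic y = cong δ (mod-cong ([m+n]%n≡m%n y m))

  drift : ℕ → ℕ → ℕ
  drift z zero    = 0
  drift z (suc t) = drift z t + disp (z + t)

  total : ℕ
  total = drift 0 m

  iter-cellAt : ∀ t x y → iter f t (cellAt x y) ≡ cellAt (x + drift (suc y) t) (y + t)
  iter-cellAt zero    x y = cong₂ cellAt (sym (+-identityʳ x)) (sym (+-identityʳ y))
  iter-cellAt (suc t) x y = begin
    f (iter f t (cellAt x y))                               ≡⟨ cong f (iter-cellAt t x y) ⟩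
    f (cellAt (x + drift (suc y) t) (y + t))                ≡⟨ f-step _ (y + t) ⟩
    cellAt (x + drift (suc y) t + disp (suc y + t)) (suc (y + t))
      ≡⟨ cong₂ cellAt (+-assoc x (drift (suc y) t) _) (sym (+-suc y t)) ⟩
    cellAt (x + drift (suc y) (suc t)) (y + suc t)          ∎

  drift-+ : ∀ z t u → drift z (t + u) ≡ drift z t + drift (z + t) u
  drift-+ z t zero    = trans (cong (drift z) (+-identityʳ t)) (sym (+-identityʳ _))
  drift-+ z t (suc u) = begin
    drift z (t + suc u)                              ≡⟨ cong (drift z) (+-suc t u) ⟩
    drift z (t + u) + disp (z + (t + u))             ≡⟨ cong₂ _+_ (drift-+ z t u) (cong disp (sym (+-assoc z t u))) ⟩
    drift z t + drift (z + t) u + disp (z + t + u)   ≡⟨ +-assoc (drift z t) _ _ ⟩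
    drift z t + drift (z + t) (suc u)                ∎

  drift-cons : ∀ z t → drift z (suc t) ≡ disp z + drift (suc z) t
  drift-cons z zero    = trans (cong disp (+-identityʳ z)) (sym (+-identityʳ (disp z)))
  drift-cons z (suc t) = begin
    drift z (suc t) + disp (z + suc t)                   ≡⟨ cong₂ _+_ (drift-cons z t) (cong disp (+-suc z t)) ⟩
    disp z + drift (suc z) t + disp (suc z + t)          ≡⟨ +-assoc (disp z) _ _ ⟩
    disp z + drift (suc z) (suc t)                       ∎

  -- By periodicity, a full turn has the same displacement from any start.
  drift-turn : ∀ z → drift z m ≡ total
  drift-turn zero    = refl
  drift-turn (suc z) = trans (+-cancelˡ-≡ (disp z) _ _ (begin
    disp z + drift (suc z) m     ≡⟨ sym (drift-cons z m) ⟩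
    drift z m + disp (z + m)     ≡⟨ cong (drift z m +_) (disp-periodic z) ⟩
    drift z m + disp z           ≡⟨ +-comm (drift z m) (disp z) ⟩
    disp z + drift z m           ∎)) (drift-turn z)

  drift-turns : ∀ z q → drift z (q * m) ≡ q * total
  drift-turns z zero    = refl
  drift-turns z (suc q) = begin
    drift z (m + q * m)                 ≡⟨ drift-+ z m (q * m) ⟩
    drift z m + drift (z + m) (q * m)   ≡⟨ cong₂ _+_ (drift-turn z) (drift-turns (z + m) q) ⟩
    total + q * total                   ∎

  iter-turns : ∀ q x y → iter f (q * m) (cellAt x y) ≡ cellAt (x + q * total) (y + q * m)
  iter-turns q x y = trans (iter-cellAt (q * m) x y)
                           (cong (λ r → cellAt (x + r) (y + q * m)) (drift-turns (suc y) q))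

  drift-constant : ∀ {z v} t → (∀ s → s < t → disp (z + s) ≡ v) → drift z t ≡ t * v
  drift-constant zero    _     = refl
  drift-constant (suc t) const = begin
    drift _ t + disp (_ + t)   ≡⟨ cong₂ _+_ (drift-constant t (λ s s<t → const s (m<n⇒m<1+n s<t)))
                                            (const t ≤-refl) ⟩
    t * _ + _                  ≡⟨ +-comm (t * _) _ ⟩
    suc t * _                  ∎

  -- Coprime displacement: first fix the column, then use full turns to fix the row.
  coprime⇒single-cycle : Coprime total n → IsSingleCycle f
  coprime⇒single-cycle coprime (i , j) (i' , j') = q * m + s , (begin
    iter f (q * m + s) (i , j)                        ≡⟨ iter-+ f (q * m) s (i , j) ⟩
    iter f (q * m) (iter f s (i , j))                 ≡⟨ cong (iter f (q * m) ∘ iter f s) (sym (cellAt-toℕ i j)) ⟩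
    iter f (q * m) (iter f s (cellAt x y))            ≡⟨ cong (iter f (q * m)) (iter-cellAt s x y) ⟩
    iter f (q * m) (cellAt r (y + s))                 ≡⟨ iter-turns q r (y + s) ⟩
    cellAt (r + q * total) (y + s + q * m)            ≡⟨ cellAt-cong rows columns ⟩
    cellAt (toℕ i') (toℕ j')                          ≡⟨ cellAt-toℕ i' j' ⟩
    (i' , j')                                         ∎)
    where
    x = toℕ i
    y = toℕ j
    s = m ∸ y % m + toℕ j'
    r = x + drift (suc y) s
    a = n ∸ r % n + toℕ i'
    q = proj₁ (coprime⇒multiples-hit coprime a)
    rows : (r + q * total) % n ≡ toℕ i' % n
    rows = trans (%-cong-+ˡ r (proj₂ (coprime⇒multiples-hit coprime a))) (catch-up r (toℕ i'))
    columns : (y + s + q * m) % m ≡ toℕ j' % m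
    columns = trans ([m+kn]%n≡m%n (y + s) q m) (catch-up y (toℕ j'))

  -- Going from row 0 to row 1 in a fixed column takes whole turns, so some
  -- multiple of the displacement is 1 modulo n.
  single-cycle⇒coprime : IsSingleCycle f → Coprime total n
  single-cycle⇒coprime cycle = invertible⇒coprime q (begin
    (q * total) % n        ≡⟨ cong (_% n) (sym (drift-turns 1 q)) ⟩
    drift 1 (q * m) % n    ≡⟨ cong (λ t → drift 1 t % n) (sym k≡qm) ⟩
    drift 1 k % n          ≡⟨ cellAt-row reached ⟩
    1 % n                  ∎)
    where
    k = proj₁ (cycle (cellAt 0 0) (cellAt 1 0))
    reached : cellAt {n} {m} (0 + drift 1 k) (0 + k) ≡ cellAt 1 0
    reached = trans (sym (iter-cellAt k 0 0)) (proj₂ (cycle (cellAt 0 0) (cellAt 1 0)))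
    q = k / m
    k≡qm : k ≡ q * m
    k≡qm = trans (m≡m%n+[m/n]*n k m)
                 (cong (_+ q * m) (trans (cellAt-column reached) (m<n⇒m%n≡m (>-nonZero⁻¹ m))))

  single-cycle⇔coprime : IsSingleCycle f ⇔ Coprime total n
  single-cycle⇔coprime = mk⇔ single-cycle⇒coprime coprime⇒single-cycle

-- A step of sign e on a cycle of length k, as a nonnegative offset.
offset : ℕ → Sign → ℕ
offset k plus  = 1
offset k minus = k ∸ 1

shift-offset : ∀ k .{{_ : NonZero k}} e x → shift k e (x mod k) ≡ (x + offset k e) mod k
shift-offset k e x =
  trans (shift-as-offset e)
        (mod-cong (Residues.%-cong-+ʳ (offset k e) (trans (cong (_% k) (toℕ-mod x)) (m%n%n≡m%n x k))))
  where
  shift-as-offset : ∀ e → shift k e (x mod k) ≡ (toℕ (x mod k) + offset k e) mod k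
  shift-as-offset plus  = refl
  shift-as-offset minus = refl

<⇒<ᵇ≡true : ∀ {a b} → a < b → (a <ᵇ b) ≡ true
<⇒<ᵇ≡true {zero}  {suc b} _         = refl
<⇒<ᵇ≡true {suc a} {suc b} (s≤s a<b) = <⇒<ᵇ≡true a<b

≤⇒<ᵇ≡false : ∀ {a b} → b ≤ a → (a <ᵇ b) ≡ false
≤⇒<ᵇ≡false {a}     {zero}  _         = refl
≤⇒<ᵇ≡false {suc a} {suc b} (s≤s b≤a) = ≤⇒<ᵇ≡false b≤a

*-pred-+ : ∀ l n .{{_ : NonZero n}} → l * (n ∸ 1) + l ≡ l * n
*-pred-+ l (suc n') = trans (+-comm (l * n') l) (sym (*-suc l n'))

module Construction (n m l : ℕ) .{{_ : NonZero n}} .{{_ : NonZero m}} where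

  move-step : ∀ x y → move n m (allPlus n) (splitC m l) (cellAt x y)
                      ≡ cellAt (x + offset n (splitC m l (suc y mod m))) (suc y)
  move-step x y = cong₂ _,_ row column
    where
    column : shift m plus (y mod m) ≡ suc y mod m
    column = trans (shift-offset m plus y) (cong (_mod m) (+-comm y 1))
    row : shift n (splitC m l (shift m plus (y mod m))) (x mod n)
          ≡ (x + offset n (splitC m l (suc y mod m))) mod n
    row = trans (cong (λ j → shift n (splitC m l j) (x mod n)) column) (shift-offset n (splitC m l (suc y mod m)) x)

  open SkewShift (offset n ∘ splitC m l) (move n m (allPlus n) (splitC m l)) move-step public

  disp-below : ∀ s → s < m → disp s ≡ offset n (if s <ᵇ m ∸ l then plus else minus)
  disp-below s s<m = cong (λ c → offset n (if c <ᵇ m ∸ l then plus else minus))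
                          (trans (toℕ-mod s) (m<n⇒m%n≡m s<m))

  -- total ≡ m - 2l (mod n), in the subtraction-free form needed below.
  total-displacement : l ≤ m → total + 2 * l ≡ m + l * n
  total-displacement l≤m = begin
    total + 2 * l                                ≡⟨ cong (λ t → drift 0 t + 2 * l) (sym (m∸n+n≡m l≤m)) ⟩
    drift 0 (m ∸ l + l) + 2 * l                  ≡⟨ cong (_+ 2 * l) (drift-+ 0 (m ∸ l) l) ⟩
    drift 0 (m ∸ l) + drift (m ∸ l) l + 2 * l    ≡⟨ cong₂ (λ a b → a + b + 2 * l) plus-columns minus-columns ⟩
    (m ∸ l) * 1 + l * (n ∸ 1) + 2 * l            ≡⟨ regroup (m ∸ l) (l * (n ∸ 1)) l ⟩
    (m ∸ l + l) + (l * (n ∸ 1) + l)              ≡⟨ cong₂ _+_ (m∸n+n≡m l≤m) (*-pred-+ l n) ⟩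
    m + l * n                                    ∎
    where
    regroup : ∀ a b l → a * 1 + b + 2 * l ≡ (a + l) + (b + l)
    regroup = solve-∀
    plus-columns : drift 0 (m ∸ l) ≡ (m ∸ l) * 1
    plus-columns = drift-constant (m ∸ l) λ s s<m∸l →
      trans (disp-below s (<-≤-trans s<m∸l (m∸n≤m m l)))
            (cong (λ b → offset n (if b then plus else minus)) (<⇒<ᵇ≡true s<m∸l))
    minus-columns : drift (m ∸ l) l ≡ l * (n ∸ 1)
    minus-columns = drift-constant l λ s s<l →
      trans (disp-below (m ∸ l + s) (<-≤-trans (+-monoʳ-< (m ∸ l) s<l) (≤-reflexive (m∸n+n≡m l≤m))))
            (cong (λ b → offset n (if b then plus else minus)) (≤⇒<ᵇ≡false (m≤m+n (m ∸ l) s)))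

lemma3p1 : (n m : ℕ) .{{_ : NonZero n}} .{{_ : NonZero m}} (l : ℕ) → l ≤ m →
    IsSolution n m (allPlus n) (splitC m l) ⇔ (gcd ∣ m - 2 * l ∣ n ≡ 1)
lemma3p1 n m l l≤m =
  ⇔-trans single-cycle⇔coprime
    (⇔-trans (coprime-difference {a = m} {k = l} (total-displacement l≤m))
             (mk⇔ coprime⇒gcd≡1 gcd≡1⇒coprime))
  where open Construction n m l
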